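{- Let $k \ge 3$ and let $\Phi$ be an E3-SAT formula with $m$ clauses and $n$ variables; let $G_\Phi$, $I_s$, $I_t$ be as in the context. If $\Phi$ is satisfiable, then there is a reconfiguration sequence from $I_s$ to $I_t$ in $G_\Phi$ under the $k$-Jump model of length at most $2(m+n)$.
   Context: Fix an integer $k \ge 3$. An E3-SAT formula is a CNF formula in which every clause has exactly three literals. Let $\Phi$ have clauses $c_0, \dots, c_{m-1}$ and variables $x_0, \dots, x_{n-1}$. The graph $G_\Phi$: for each clause $c_i$, a path $v^i_0 v^i_1 \cdots v^i_{2k}$, with $k^i_1 = v^i_k$, plus vertices $k^i_0, k^i_2$ each adjacent to $v^i_{k-1}$ and $v^i_{k+1}$; for each variable $x_j$, a path $u^j_0 \cdots u^j_{k-1}$ with $t^j_0 = u^j_0$, $t^j_1 = u^j_{k-1}$, plus vertices $s^j_0, s^j_1$ each adjacent to $t^j_0$; the set $K = \{k^i_0, k^i_1, k^i_2 : 0 \le i < m\}$ is a clique; for each clause $c_i = (\ell_0 \vee \ell_1 \vee \ell_2)$ and $r \in \{0,1,2\}$, with $x_j$ the variable of $\ell_r$, add edges $\{s^j_0, k^i_r\}, \{t^j_0, k^i_r\}$ if $\ell_r$ is positive and $\{s^j_1, k^i_r\}, \{t^j_0, k^i_r\}$ if $\ell_r$ is negative; no other edges. $I_s = \{v^i_0 : 0 \le i < m\} \cup \{s^j_0, s^j_1 : 0 \le j < n\}$ and $I_t = \{v^i_{2k} : 0 \le i < m\} \cup \{t^j_0, t^j_1 : 0 \le j < n\}$. For independent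 sets $I, J$, write $I \leftrightarrow_k J$ if $|I \setminus J| = |J \setminus I| = 1$ and $\mathrm{dist}_{G_\Phi}(u,v) \le k$ where $I \setminus J = \{u\}$, $J \setminus I = \{v\}$. A reconfiguration sequence of length $\ell$ from $I_s$ to $I_t$ is a sequence $I_s = I_0, \dots, I_\ell = I_t$ of independent sets with $I_j \leftrightarrow_k I_{j+1}$ for all $j$. -}

module Defs where

open import Data.Nat using (ℕ; zero; suc; _+_; _*_; _∸_; _≤_; _<_; _≡ᵇ_; s≤s)
open import Data.Nat.Properties using (m≤m+n)
open import Data.Fin using (Fin; zero; suc; toℕ; fromℕ<; fromℕ; inject₁)
open import Data.Bool using (Bool; true; false; _∨_; not)
open import Data.Product using (Σ; ∃; ∃-syntax; _×_; _,_; proj₁; proj₂)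
open import Data.Sum using (_⊎_)
open import Relation.Nullary using (¬_)
open import Relation.Binary.PropositionalEquality using (_≡_; _≢_)

VSet : Set → Set
VSet V = V → Bool

data Walk {V : Set} (Adj : V → V → Set) : ℕ → V → V → Set where
  nil  : ∀ {x} → Walk Adj 0 x x
  cons : ∀ {l x y z} → Adj x y → Walk Adj l y z → Walk Adj (suc l) x z

DistLe : {V : Set} → (V → V → Set) → ℕ → V → V → Set
DistLe Adj d x y = ∃[ l ] (l ≤ d × Walk Adj l x y)

Independent : {V : Set} → (V → V → Set) → VSet V → Set
Independent Adj I = ∀ x y → I x ≡ true → I y ≡ true → ¬ Adj x y

JumpStep : {V : Set} → (V → V → Set) → ℕ → VSet V → VSet V → Set
JumpStep Adj d I J =
  ∃[ x ] ∃[ y ]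
    (I x ≡ true × J x ≡ false × I y ≡ false × J y ≡ true
     × (∀ z → z ≢ x → z ≢ y → I z ≡ J z)
     × DistLe Adj d x y)

_≐_ : {V : Set} → VSet V → VSet V → Set
I ≐ J = ∀ z → I z ≡ J z

record ReconfSeq {V : Set} (Adj : V → V → Set) (d : ℕ) (I J : VSet V) (ℓ : ℕ) : Set where
  field
    seq   : Fin (suc ℓ) → VSet V
    start : seq zero ≐ I
    end   : seq (fromℕ ℓ) ≐ J
    indep : ∀ i → Independent Adj (seq i)
    steps : ∀ (i : Fin ℓ) → JumpStep Adj d (seq (inject₁ i)) (seq (suc i))

-- A literal: a variable and a polarity (true = positive, false = negated).
Literal : ℕ → Set
Literal n = Fin n × Bool

var : ∀ {n} → Literal n → Fin n
var = proj₁

-- m clauses over n variables, each clause is (ℓ₀ ∨ ℓ₁ ∨ ℓ₂).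
Formula : ℕ → ℕ → Set
Formula m n = Fin m → Fin 3 → Literal n

IsE3 : ∀ {m n} → Formula m n → Set
IsE3 Φ = ∀ i (r r' : Fin 3) → Φ i r ≡ Φ i r' → r ≡ r'

litValue : ∀ {n} → (Fin n → Bool) → Literal n → Bool
litValue α (x , true)  = α x
litValue α (x , false) = not (α x)

Satisfiable : ∀ {m n} → Formula m n → Set
Satisfiable {m} {n} Φ = ∃[ α ] (∀ (i : Fin m) → ∃[ r ] litValue {n} α (Φ i r) ≡ true)

data Vertex (k m n : ℕ) : Set where
  v   : Fin m → Fin (suc (k + k)) → Vertex k m n
  kc0 : Fin m → Vertex k m n
  kc2 : Fin m → Vertex k m n
  u   : Fin n → Fin k → Vertex k m n
  s   : Fin n → Fin 2 → Vertex k m n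

midIdx : (k : ℕ) → Fin (suc (k + k))
midIdx k = fromℕ< (s≤s (m≤m+n k k))

-- k^i_r  (with k^i_1 = v^i_k)
kv : ∀ {k m n} → Fin m → Fin 3 → Vertex k m n
kv i zero             = kc0 i
kv {k} i (suc zero)   = v i (midIdx k)
kv i (suc (suc zero)) = kc2 i

sideOf : ∀ {n} → Literal n → Fin 2
sideOf (_ , true)  = zero
sideOf (_ , false) = suc zero

data InK {k m n : ℕ} : Vertex k m n → Set where
  inK : ∀ i r → InK (kv i r)

data Edge (k : ℕ) {m n : ℕ} (Φ : Formula m n) : Vertex k m n → Vertex k m n → Set where
  pathC : ∀ i a b → toℕ b ≡ suc (toℕ a) → Edge k Φ (v i a) (v i b)
  k0L : ∀ i b → suc (toℕ b) ≡ k → Edge k Φ (kc0 i) (v i b)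
  k0R : ∀ i b → toℕ b ≡ suc k → Edge k Φ (kc0 i) (v i b)
  k2L : ∀ i b → suc (toℕ b) ≡ k → Edge k Φ (kc2 i) (v i b)
  k2R : ∀ i b → toℕ b ≡ suc k → Edge k Φ (kc2 i) (v i b)
  pathV : ∀ j a b → toℕ b ≡ suc (toℕ a) → Edge k Φ (u j a) (u j b)
  -- s^j_0, s^j_1 adjacent to t^j_0 = u^j_0
  st : ∀ j c a → toℕ a ≡ 0 → Edge k Φ (s j c) (u j a)
  clique : ∀ x y → InK x → InK y → x ≢ y → Edge k Φ x y
  litS : ∀ i r → Edge k Φ (s (var (Φ i r)) (sideOf (Φ i r))) (kv i r)
  litT : ∀ i r a → toℕ a ≡ 0 → Edge k Φ (u (var (Φ i r)) a) (kv i r)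

Adj : (k : ℕ) → ∀ {m n} → Formula m n → Vertex k m n → Vertex k m n → Set
Adj k Φ x y = Edge k Φ x y ⊎ Edge k Φ y x

Is : (k : ℕ) → ∀ {m n} → VSet (Vertex k m n)
Is k (v i a)   = toℕ a ≡ᵇ 0
Is k (kc0 i)   = false
Is k (kc2 i)   = false
Is k (u j a)   = false
Is k (s j c)   = true

-- I_t = {v^i_{2k}} ∪ {t^j_0 = u^j_0, t^j_1 = u^j_{k-1}}
It : (k : ℕ) → ∀ {m n} → VSet (Vertex k m n)
It k (v i a)   = toℕ a ≡ᵇ (k + k)
It k (kc0 i)   = false
It k (kc2 i)   = false
It k (u j a)   = (toℕ a ≡ᵇ 0) ∨ (toℕ a ≡ᵇ (k ∸ 1))
It k (s j c)   = false

{-# OPTIONS --safe #-}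
-- Fix a satisfying assignment α and, in every clause c_i, a true literal ℓ_{key i}.  The tokens
-- move in three sweeps, every jump of length at most k: first each variable sends the token on
-- the s-vertex of its true literal along s → t_0 → ⋯ → t_1; then each clause sends its token
-- v_0 → k_{key i} → v_{2k}; last each variable sends its remaining s-token to t_0.  That is
-- n + 2m + n jumps.  Every intermediate set is described by a stage of each gadget, and the only
-- edges between gadgets join K to s- and t_0-vertices.  So independence needs just two facts
-- while a clause token sits in K: it is the only token there, and the s- and t_0-vertices
-- adjacent to k_{key i} are empty because the variable of ℓ_{key i} has made its first move.
module Submission where

open import Defs
open import Data.Nat using (ℕ; zero; suc; _+_; _*_; _∸_; _≤_; _<_; _≡ᵇ_; _<ᵇ_; s≤s; z≤n)
open import Data.Nat.Properties
  using (≡ᵇ⇒≡; <⇒<ᵇ; _≟_; +-identityʳ; +-suc; +-comm; +-monoˡ-≤; ≤-refl; ≤-reflexive; ≤-trans;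
         ≤-<-trans; m≤m+n; n≤1+n; m<n⇒m<1+n; <-irrefl; 1+n≢n; 1+n≢0; 0≢1+n; suc-injective; m≢1+m+n)
open import Data.Nat.Tactic.RingSolver using (solve-∀)
open import Data.Fin using (Fin; zero; suc; toℕ; fromℕ; fromℕ<; inject₁)
open import Data.Fin.Properties
  using (toℕ-injective; toℕ<n; toℕ-fromℕ; toℕ-fromℕ<) renaming (_≟_ to _≟ᶠ_)
open import Data.Bool using (Bool; true; false; _∧_; _∨_; not; if_then_else_)
open import Data.Bool.Properties using (T-≡; ∧-conicalˡ; ∧-conicalʳ; ¬-not)
open import Data.Product using (∃-syntax; _×_; _,_; proj₁; proj₂)
open import Data.Sum using (_⊎_; inj₁; inj₂; [_,_]′)
open import Data.Sum.Properties using () renaming (≡-dec to ⊎-≡-dec)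
open import Data.Vec.Functional using (updateAt)
open import Data.Vec.Functional.Properties using (updateAt-updates; updateAt-minimal)
open import Data.Empty using (⊥; ⊥-elim)
open import Function using (_∘_; const; Equivalence)
open import Relation.Nullary using (¬_; yes; no; does)
open import Relation.Nullary.Decidable using (dec-true; dec-false)
open import Relation.Binary.Definitions using (DecidableEquality)
open import Relation.Binary.PropositionalEquality using (_≡_; _≢_; refl; sym; trans; cong; subst)

≡ᵇ-true⇒≡ : ∀ {m n} → (m ≡ᵇ n) ≡ true → m ≡ n
≡ᵇ-true⇒≡ {m} {n} h = ≡ᵇ⇒≡ m n (Equivalence.from T-≡ h)

≡⇒≡ᵇ-true : ∀ {m n} → m ≡ n → (m ≡ᵇ n) ≡ true
≡⇒≡ᵇ-true {m} {n} = dec-true (m ≟ n)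

≢⇒≡ᵇ-false : ∀ {m n} → m ≢ n → (m ≡ᵇ n) ≡ false
≢⇒≡ᵇ-false {m} {n} = dec-false (m ≟ n)

<⇒<ᵇ-true : ∀ {m n} → m < n → (m <ᵇ n) ≡ true
<⇒<ᵇ-true m<n = Equivalence.to T-≡ (<⇒<ᵇ m<n)

<ᵇ-irrefl : ∀ n → (n <ᵇ n) ≡ false
<ᵇ-irrefl zero = refl
<ᵇ-irrefl (suc n) = <ᵇ-irrefl n

<ᵇ-1+n : ∀ n → (n <ᵇ suc n) ≡ true
<ᵇ-1+n zero = refl
<ᵇ-1+n (suc n) = <ᵇ-1+n n

<ᵇ-1+n-≢ : ∀ {m n} → m ≢ n → (m <ᵇ n) ≡ (m <ᵇ suc n)
<ᵇ-1+n-≢ {zero} {zero} m≢n = ⊥-elim (m≢n refl)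
<ᵇ-1+n-≢ {zero} {suc n} _ = refl
<ᵇ-1+n-≢ {suc m} {zero} _ = refl
<ᵇ-1+n-≢ {suc m} {suc n} m≢n = <ᵇ-1+n-≢ (m≢n ∘ cong suc)

≢⇒toℕ≢ : ∀ {N} {a b : Fin N} {c} → a ≢ b → toℕ b ≡ c → toℕ a ≢ c
≢⇒toℕ≢ a≢b b≡c a≡c = a≢b (toℕ-injective (trans a≡c (sym b≡c)))

infix 4 _≗_except_

_≗_except_ : ∀ {A B : Set} → (A → B) → (A → B) → A → Set
f ≗ g except a = ∀ a′ → a′ ≢ a → f a′ ≡ g a′

module _ {A B C : Set} where

  except-inj₁ : ∀ {Y Y′ : A → C} {X : B → C} {i} →
                Y ≗ Y′ except i → [ Y , X ]′ ≗ [ Y′ , X ]′ except inj₁ i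
  except-inj₁ agree (inj₁ i′) i′≢i = agree i′ (i′≢i ∘ cong inj₁)
  except-inj₁ agree (inj₂ j′) _ = refl

  except-inj₂ : ∀ {Y : A → C} {X X′ : B → C} {j} →
                X ≗ X′ except j → [ Y , X ]′ ≗ [ Y , X′ ]′ except inj₂ j
  except-inj₂ agree (inj₁ i′) _ = refl
  except-inj₂ agree (inj₂ j′) j′≢j = agree j′ (j′≢j ∘ cong inj₂)

module _ {A : Set} {N : ℕ} where

  overwriteBelow : ℕ → A → (Fin N → A) → Fin N → A
  overwriteBelow p a f j = if toℕ j <ᵇ p then a else f j

  overwriteBelow-all : ∀ a f j → overwriteBelow N a f j ≡ a
  overwriteBelow-all a f j rewrite <⇒<ᵇ-true (toℕ<n j) = refl

  module _ {p} (p<N : p < N) (a : A) (f : Fin N → A) where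

    overwriteBelow-at : overwriteBelow p a f (fromℕ< p<N) ≡ f (fromℕ< p<N)
    overwriteBelow-at rewrite toℕ-fromℕ< p<N | <ᵇ-irrefl p = refl

    overwriteBelow-1+-at : overwriteBelow (suc p) a f (fromℕ< p<N) ≡ a
    overwriteBelow-1+-at rewrite toℕ-fromℕ< p<N | <ᵇ-1+n p = refl

    overwriteBelow-1+-except : overwriteBelow p a f ≗ overwriteBelow (suc p) a f except fromℕ< p<N
    overwriteBelow-1+-except j j≢p rewrite <ᵇ-1+n-≢ (≢⇒toℕ≢ j≢p (toℕ-fromℕ< p<N)) = refl

data ReconfPath {V : Set} (Adj : V → V → Set) (d : ℕ) : VSet V → VSet V → ℕ → Set where
  stop : ∀ {I} → Independent Adj I → ReconfPath Adj d I I 0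
  jump : ∀ {I J K l} → Independent Adj I → JumpStep Adj d I J → ReconfPath Adj d J K l →
         ReconfPath Adj d I K (suc l)

module _ {V : Set} {Adj : V → V → Set} {d : ℕ} where

  infixr 5 _++ᴿ_

  _++ᴿ_ : ∀ {I J K l l′} → ReconfPath Adj d I J l → ReconfPath Adj d J K l′ →
          ReconfPath Adj d I K (l + l′)
  stop _ ++ᴿ q = q
  jump indI step p ++ᴿ q = jump indI step (p ++ᴿ q)

  single : ∀ {I J} → Independent Adj I → Independent Adj J → JumpStep Adj d I J →
           ReconfPath Adj d I J 1
  single indI indJ step = jump indI step (stop indJ)

  sweep : ∀ (S : ℕ → VSet V) {c} N → Independent Adj (S 0) →
          (∀ p → p < N → ReconfPath Adj d (S p) (S (suc p)) c) → ReconfPath Adj d (S 0) (S N) (N * c)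
  sweep S zero indS₀ _ = stop indS₀
  sweep S {c} (suc N) indS₀ stage =
    subst (ReconfPath Adj d (S 0) (S (suc N))) (+-comm (N * c) c)
      (sweep S N indS₀ (λ p p<N → stage p (m<n⇒m<1+n p<N)) ++ᴿ stage N ≤-refl)

  -- Splitting on the index first makes `states p zero` reduce to I whatever p is, which the
  -- first clause of states-jump needs.
  states : ∀ {I J l} → ReconfPath Adj d I J l → Fin (suc l) → VSet V
  states {I} _ zero = I
  states (stop _) (suc ())
  states (jump _ _ p) (suc i) = states p i

  states-last : ∀ {I J l} (p : ReconfPath Adj d I J l) → states p (fromℕ l) ≡ J
  states-last (stop _) = refl
  states-last (jump _ _ p) = states-last p

  states-independent : ∀ {I J l} (p : ReconfPath Adj d I J l) i → Independent Adj (states p i)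
  states-independent (stop indI) zero = indI
  states-independent (jump indI _ _) zero = indI
  states-independent (jump _ _ p) (suc i) = states-independent p i

  states-jump : ∀ {I J l} (p : ReconfPath Adj d I J l) (i : Fin l) →
                JumpStep Adj d (states p (inject₁ i)) (states p (suc i))
  states-jump (jump _ step _) zero = step
  states-jump (jump _ _ p) (suc i) = states-jump p i

  toReconfSeq : ∀ {I J I′ J′ l} → ReconfPath Adj d I J l → I ≐ I′ → J ≐ J′ →
                ReconfSeq Adj d I′ J′ l
  toReconfSeq p I≐I′ J≐J′ = record
    { seq   = states p
    ; start = I≐I′
    ; end   = λ z → trans (cong (λ I → I z) (states-last p)) (J≐J′ z)
    ; indep = states-independent p
    ; steps = states-jump p
    }

module _ {V : Set} {Adj : V → V → Set} where

  _▷_ : ∀ {l x y z} → Walk Adj l x y → Adj y z → Walk Adj (suc l) x z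
  nil ▷ e = cons e nil
  cons e′ w ▷ e = cons e′ (w ▷ e)

  walkAlong : ∀ {N} (p : Fin N → V) → (∀ {a b} → toℕ b ≡ suc (toℕ a) → Adj (p a) (p b)) →
              ∀ d {a b} → toℕ a + d ≡ toℕ b → Walk Adj d (p a) (p b)
  walkAlong p edge zero {a} {b} a+0≡b
    with toℕ-injective {i = a} {j = b} (trans (sym (+-identityʳ _)) a+0≡b)
  ... | refl = nil
  walkAlong {N} p edge (suc d) {a} {b} a+d+1≡b =
    cons (edge {b = next} (toℕ-fromℕ< a+1<N))
         (walkAlong p edge d (trans (cong (_+ d) (toℕ-fromℕ< a+1<N)) a+1+d≡b))
    where
      a+1+d≡b : suc (toℕ a) + d ≡ toℕ b
      a+1+d≡b = trans (sym (+-suc (toℕ a) d)) a+d+1≡b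
      a+1<N : suc (toℕ a) < N
      a+1<N = ≤-<-trans (subst (suc (toℕ a) ≤_) a+1+d≡b (m≤m+n (suc (toℕ a)) d)) (toℕ<n b)
      next : Fin N
      next = fromℕ< a+1<N

module Gadgets {V G S : Set} (_≟ᴳ_ : DecidableEquality G) (owner : V → G) (occupies : S → V → Bool)
  where

  configuration : (G → S) → VSet V
  configuration σ z = occupies (σ (owner z)) z

  configuration-cong : ∀ {σ σ′} → (∀ g → σ g ≡ σ′ g) → configuration σ ≐ configuration σ′
  configuration-cong σ≗σ′ z = cong (λ t → occupies t z) (σ≗σ′ (owner z))

  configuration-owned : ∀ {σ g t z} → owner z ≡ g → σ g ≡ t → configuration σ z ≡ occupies t z
  configuration-owned refl refl = refl

  occupied-at : ∀ {σ g t} z → owner z ≡ g → σ g ≡ t → configuration σ z ≡ true → occupies t z ≡ true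
  occupied-at z refl refl h = h

  record GadgetMove (Adj : V → V → Set) (d : ℕ) (g : G) (t t′ : S) : Set where
    field
      from to       : V
      from-owned    : owner from ≡ g
      to-owned      : owner to ≡ g
      from-before   : occupies t from ≡ true
      from-after    : occupies t′ from ≡ false
      to-before     : occupies t to ≡ false
      to-after      : occupies t′ to ≡ true
      others        : ∀ z → owner z ≡ g → z ≢ from → z ≢ to → occupies t z ≡ occupies t′ z
      from-to-close : DistLe Adj d from to

  jumpStep-gadget : ∀ {Adj d σ σ′ g t t′} → σ ≗ σ′ except g → σ g ≡ t → σ′ g ≡ t′ →
                    GadgetMove Adj d g t t′ → JumpStep Adj d (configuration σ) (configuration σ′)
  jumpStep-gadget {σ = σ} {σ′} {g} agree σg≡t σ′g≡t′ move =
    from , to ,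
    trans (configuration-owned from-owned σg≡t) from-before ,
    trans (configuration-owned from-owned σ′g≡t′) from-after ,
    trans (configuration-owned to-owned σg≡t) to-before ,
    trans (configuration-owned to-owned σ′g≡t′) to-after ,
    unchanged , from-to-close
    where
      open GadgetMove move
      unchanged : ∀ z → z ≢ from → z ≢ to → configuration σ z ≡ configuration σ′ z
      unchanged z z≢from z≢to with owner z ≟ᴳ g
      ... | yes z∈g = trans (configuration-owned z∈g σg≡t)
                        (trans (others z z∈g z≢from z≢to) (sym (configuration-owned z∈g σ′g≡t′)))
      ... | no z∉g = cong (λ t → occupies t z) (agree (owner z) z∉g)

satisfied-literal : ∀ {n} (α : Fin n → Bool) (ℓ : Literal n) →
                    litValue α ℓ ≡ true → ℓ ≡ (var ℓ , α (var ℓ))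
satisfied-literal α (x , true) αx = cong (x ,_) (sym αx)
satisfied-literal α (x , false) ¬αx with α x
... | false = refl

sideOf-not : ∀ {n} (x : Fin n) b → sideOf (x , b) ≢ sideOf (x , not b)
sideOf-not x true = λ ()
sideOf-not x false = λ ()

sideOf-either : ∀ {n} (x : Fin n) b c → c ≡ sideOf (x , b) ⊎ c ≡ sideOf (x , not b)
sideOf-either x true zero = inj₁ refl
sideOf-either x true (suc zero) = inj₂ refl
sideOf-either x false zero = inj₂ refl
sideOf-either x false (suc zero) = inj₁ refl

data Stage : Set where
  initial midway final : Stage

module Construction (q : ℕ) {m n : ℕ} (Φ : Formula m n) (α : Fin n → Bool)
                    (key : Fin m → Fin 3) (key-true : ∀ i → litValue α (Φ i (key i)) ≡ true) where

  k : ℕ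
  k = 3 + q

  trueSide falseSide : Fin n → Fin 2
  trueSide j = sideOf (j , α j)
  falseSide j = sideOf (j , not (α j))

  owner : Vertex k m n → Fin m ⊎ Fin n
  owner (v i _) = inj₁ i
  owner (kc0 i) = inj₁ i
  owner (kc2 i) = inj₁ i
  owner (u j _) = inj₂ j
  owner (s j _) = inj₂ j

  -- Stages initial / midway / final put the clause token on v_0 / k_{key i} (where k_1 = v_k) /
  -- v_{2k}, and the variable tokens on s_0, s_1 / the false-side s-vertex and t_1 = u_{k-1} / t_0, t_1.
  occupies : Stage → Vertex k m n → Bool
  occupies initial (v i a) = toℕ a ≡ᵇ 0
  occupies midway  (v i a) = (toℕ (key i) ≡ᵇ 1) ∧ (toℕ a ≡ᵇ k)
  occupies final   (v i a) = toℕ a ≡ᵇ k + k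
  occupies initial (kc0 i) = false
  occupies midway  (kc0 i) = toℕ (key i) ≡ᵇ 0
  occupies final   (kc0 i) = false
  occupies initial (kc2 i) = false
  occupies midway  (kc2 i) = toℕ (key i) ≡ᵇ 2
  occupies final   (kc2 i) = false
  occupies initial (u j a) = false
  occupies midway  (u j a) = toℕ a ≡ᵇ k ∸ 1
  occupies final   (u j a) = (toℕ a ≡ᵇ 0) ∨ (toℕ a ≡ᵇ k ∸ 1)
  occupies initial (s j c) = true
  occupies midway  (s j c) = does (c ≟ᶠ falseSide j)
  occupies final   (s j c) = false

  open Gadgets (⊎-≡-dec _≟ᶠ_ _≟ᶠ_) owner occupies

  tokens : (Fin m → Stage) → (Fin n → Stage) → VSet (Vertex k m n)
  tokens Y X = configuration [ Y , X ]′

  Reconf : VSet (Vertex k m n) → VSet (Vertex k m n) → ℕ → Set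
  Reconf = ReconfPath (Adj k Φ) k

  mid lastV beforeMid afterMid : Fin (suc (k + k))
  mid = midIdx k
  lastV = fromℕ (k + k)
  beforeMid = fromℕ< {2 + q} (s≤s (≤-trans (n≤1+n (2 + q)) (m≤m+n k k)))
  afterMid = fromℕ< {suc k} (s≤s (+-monoˡ-≤ k {1} {k} (s≤s z≤n)))

  lastU : Fin k
  lastU = fromℕ (2 + q)

  toℕ-mid : toℕ mid ≡ k
  toℕ-mid = toℕ-fromℕ< (s≤s (m≤m+n k k))

  toℕ-beforeMid : toℕ beforeMid ≡ 2 + q
  toℕ-beforeMid = toℕ-fromℕ< (s≤s (≤-trans (n≤1+n (2 + q)) (m≤m+n k k)))

  toℕ-afterMid : toℕ afterMid ≡ suc k
  toℕ-afterMid = toℕ-fromℕ< (s≤s (+-monoˡ-≤ k {1} {k} (s≤s z≤n)))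

  k≢k+k : k ≢ k + k
  k≢k+k k≡k+k = m≢1+m+n k (trans k≡k+k (+-suc k (2 + q)))

  clausePath : ∀ i d {a b} → toℕ a + d ≡ toℕ b → Walk (Adj k Φ) d (v i a) (v i b)
  clausePath i = walkAlong (v i) (λ b≡a+1 → inj₁ (pathC i _ _ b≡a+1))

  variablePath : ∀ j d {a b} → toℕ a + d ≡ toℕ b → Walk (Adj k Φ) d (u j a) (u j b)
  variablePath j = walkAlong (u j) (λ b≡a+1 → inj₁ (pathV j _ _ b≡a+1))

  dist-v₀-kv : ∀ i r → DistLe (Adj k Φ) k (v i zero) (kv i r)
  dist-v₀-kv i zero = k , ≤-refl ,
    clausePath i (2 + q) (sym toℕ-beforeMid) ▷ inj₂ (k0L i beforeMid (cong suc toℕ-beforeMid))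
  dist-v₀-kv i (suc zero) = k , ≤-refl , clausePath i k (sym toℕ-mid)
  dist-v₀-kv i (suc (suc zero)) = k , ≤-refl ,
    clausePath i (2 + q) (sym toℕ-beforeMid) ▷ inj₂ (k2L i beforeMid (cong suc toℕ-beforeMid))

  afterMid+k-1≡2k : toℕ afterMid + (2 + q) ≡ toℕ lastV
  afterMid+k-1≡2k =
    trans (cong (_+ (2 + q)) toℕ-afterMid) (trans (sym (+-suc k (2 + q))) (sym (toℕ-fromℕ (k + k))))

  dist-kv-v₂ₖ : ∀ i r → DistLe (Adj k Φ) k (kv i r) (v i lastV)
  dist-kv-v₂ₖ i zero = k , ≤-refl ,
    cons (inj₁ (k0R i afterMid toℕ-afterMid)) (clausePath i (2 + q) afterMid+k-1≡2k)
  dist-kv-v₂ₖ i (suc zero) = k , ≤-refl ,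
    clausePath i k (trans (cong (_+ k) toℕ-mid) (sym (toℕ-fromℕ (k + k))))
  dist-kv-v₂ₖ i (suc (suc zero)) = k , ≤-refl ,
    cons (inj₁ (k2R i afterMid toℕ-afterMid)) (clausePath i (2 + q) afterMid+k-1≡2k)

  owner-kv : ∀ i r → owner (kv i r) ≡ inj₁ i
  owner-kv i zero = refl
  owner-kv i (suc zero) = refl
  owner-kv i (suc (suc zero)) = refl

  v-injectiveʳ : ∀ {i i′ a b} → v {k} {m} {n} i a ≡ v i′ b → a ≡ b
  v-injectiveʳ refl = refl

  kv-injectiveʳ : ∀ {i r r′} → kv {k} {m} {n} i r ≡ kv i r′ → r ≡ r′
  kv-injectiveʳ {r = zero} {zero} _ = refl
  kv-injectiveʳ {r = suc zero} {suc zero} _ = refl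
  kv-injectiveʳ {r = suc (suc zero)} {suc (suc zero)} _ = refl
  kv-injectiveʳ {r = zero} {suc zero} ()
  kv-injectiveʳ {r = zero} {suc (suc zero)} ()
  kv-injectiveʳ {r = suc zero} {zero} ()
  kv-injectiveʳ {r = suc zero} {suc (suc zero)} ()
  kv-injectiveʳ {r = suc (suc zero)} {zero} ()
  kv-injectiveʳ {r = suc (suc zero)} {suc zero} ()

  v₀≢kv : ∀ i r → v {k} {m} {n} i zero ≢ kv i r
  v₀≢kv i zero = λ ()
  v₀≢kv i (suc zero) = λ ()
  v₀≢kv i (suc (suc zero)) = λ ()

  v₂ₖ≢kv : ∀ i r → v {k} {m} {n} i lastV ≢ kv i r
  v₂ₖ≢kv i zero = λ ()
  v₂ₖ≢kv i (suc zero) v₂ₖ≡vₖ =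
    k≢k+k (trans (sym toℕ-mid) (trans (cong toℕ (sym (v-injectiveʳ v₂ₖ≡vₖ))) (toℕ-fromℕ (k + k))))
  v₂ₖ≢kv i (suc (suc zero)) = λ ()

  clauseToken : Stage → Fin m → Vertex k m n
  clauseToken initial i = v i zero
  clauseToken midway i = kv i (key i)
  clauseToken final i = v i lastV

  owner-clauseToken : ∀ t i → owner (clauseToken t i) ≡ inj₁ i
  owner-clauseToken initial i = refl
  owner-clauseToken midway i = owner-kv i (key i)
  owner-clauseToken final i = refl

  midway-kv : ∀ i r → key i ≡ r → occupies midway (kv i r) ≡ true
  midway-kv i zero key≡r rewrite key≡r = refl
  midway-kv i (suc zero) key≡r rewrite key≡r = ≡⇒≡ᵇ-true toℕ-mid
  midway-kv i (suc (suc zero)) key≡r rewrite key≡r = refl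

  clauseToken-occupied : ∀ t i → occupies t (clauseToken t i) ≡ true
  clauseToken-occupied initial i = refl
  clauseToken-occupied midway i = midway-kv i (key i) refl
  clauseToken-occupied final i = ≡⇒≡ᵇ-true (toℕ-fromℕ (k + k))

  occupied⇒clauseToken : ∀ t {i} z → owner z ≡ inj₁ i → occupies t z ≡ true → z ≡ clauseToken t i
  occupied⇒clauseToken initial (v i a) refl h = cong (v i) (toℕ-injective (≡ᵇ-true⇒≡ h))
  occupied⇒clauseToken midway (v i a) refl h =
    trans (cong (v i) (toℕ-injective (trans (≡ᵇ-true⇒≡ (∧-conicalʳ _ _ h)) (sym toℕ-mid))))
          (cong (kv i) (sym (toℕ-injective {j = suc zero} (≡ᵇ-true⇒≡ (∧-conicalˡ _ _ h)))))
  occupied⇒clauseToken final (v i a) refl h =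
    cong (v i) (toℕ-injective (trans (≡ᵇ-true⇒≡ h) (sym (toℕ-fromℕ (k + k)))))
  occupied⇒clauseToken midway (kc0 i) refl h =
    cong (kv i) (sym (toℕ-injective {i = key i} {j = zero} (≡ᵇ-true⇒≡ h)))
  occupied⇒clauseToken midway (kc2 i) refl h =
    cong (kv i) (sym (toℕ-injective {i = key i} {j = suc (suc zero)} (≡ᵇ-true⇒≡ h)))
  occupied⇒clauseToken initial (kc0 i) refl ()
  occupied⇒clauseToken final (kc0 i) refl ()
  occupied⇒clauseToken initial (kc2 i) refl ()
  occupied⇒clauseToken final (kc2 i) refl ()

  clause-empty : ∀ t {i} z → owner z ≡ inj₁ i → z ≢ clauseToken t i → occupies t z ≡ false
  clause-empty t z z∈i z≢token = ¬-not (z≢token ∘ occupied⇒clauseToken t z z∈i)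

  kv-clauseToken : ∀ t i r → kv i r ≡ clauseToken t i → t ≡ midway × key i ≡ r
  kv-clauseToken initial i r kv≡v₀ = ⊥-elim (v₀≢kv i r (sym kv≡v₀))
  kv-clauseToken midway i r kv≡key = refl , sym (kv-injectiveʳ kv≡key)
  kv-clauseToken final i r kv≡v₂ₖ = ⊥-elim (v₂ₖ≢kv i r (sym kv≡v₂ₖ))

  occupied-u : ∀ t j a → occupies t (u j a) ≡ true → toℕ a ≡ k ∸ 1 ⊎ toℕ a ≡ 0
  occupied-u midway j a h = inj₁ (≡ᵇ-true⇒≡ h)
  occupied-u final j a h with toℕ a ≡ᵇ 0 in a≡0
  ... | true = inj₂ (≡ᵇ-true⇒≡ a≡0)
  ... | false = inj₁ (≡ᵇ-true⇒≡ h)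

  occupied-midway-s : ∀ j c → occupies midway (s j c) ≡ true → c ≡ falseSide j
  occupied-midway-s j c h with c ≟ᶠ falseSide j
  ... | yes c≡false = c≡false

  midway-t₀-empty : ∀ j {a} → toℕ a ≡ 0 → occupies midway (u j a) ≡ true → ⊥
  midway-t₀-empty j a≡0 ha = 0≢1+n (trans (sym a≡0) (≡ᵇ-true⇒≡ ha))

  variablePath-noEdge : ∀ t {j a b} → toℕ b ≡ suc (toℕ a) →
                        occupies t (u j a) ≡ true → occupies t (u j b) ≡ true → ⊥
  variablePath-noEdge t {j} {a} {b} b≡a+1 ha hb with occupied-u t j a ha | occupied-u t j b hb
  ... | inj₁ a≡k-1 | _ = <-irrefl (trans b≡a+1 (cong suc a≡k-1)) (toℕ<n b)
  ... | inj₂ a≡0 | inj₁ b≡k-1 =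
    0≢1+n (suc-injective (trans (sym (trans b≡a+1 (cong suc a≡0))) b≡k-1))
  ... | inj₂ a≡0 | inj₂ b≡0 = 1+n≢0 (trans (sym (trans b≡a+1 (cong suc a≡0))) b≡0)

  side-t₀-noEdge : ∀ t {j c a} → toℕ a ≡ 0 →
                   occupies t (s j c) ≡ true → occupies t (u j a) ≡ true → ⊥
  side-t₀-noEdge midway {j} a≡0 _ ha = midway-t₀-empty j a≡0 ha
  side-t₀-noEdge final _ () _

  record Consistent (σ : Fin m ⊎ Fin n → Stage) : Set where
    field
      midway-unique : ∀ {i i′} → σ (inj₁ i) ≡ midway → σ (inj₁ i′) ≡ midway → i ≡ i′
      midway-lifted : ∀ {i} → σ (inj₁ i) ≡ midway → σ (inj₂ (var (Φ i (key i)))) ≡ midway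

  clause-occupied : ∀ {σ i} z → owner z ≡ inj₁ i → configuration σ z ≡ true →
                    z ≡ clauseToken (σ (inj₁ i)) i
  clause-occupied {σ} {i} z z∈i h =
    occupied⇒clauseToken (σ (inj₁ i)) z z∈i (occupied-at {σ} z z∈i refl h)

  clause-occupied-unique : ∀ {σ i} x y → owner x ≡ inj₁ i → owner y ≡ inj₁ i →
                           configuration σ x ≡ true → configuration σ y ≡ true → x ≡ y
  clause-occupied-unique {σ} x y x∈i y∈i hx hy =
    trans (clause-occupied {σ} x x∈i hx) (sym (clause-occupied {σ} y y∈i hy))

  occupied-kv : ∀ {σ} i r → configuration σ (kv i r) ≡ true → σ (inj₁ i) ≡ midway × key i ≡ r
  occupied-kv {σ} i r h = kv-clauseToken (σ (inj₁ i)) i r (clause-occupied {σ} (kv i r) (owner-kv i r) h)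

  keySide-true : ∀ i → sideOf (Φ i (key i)) ≡ trueSide (var (Φ i (key i)))
  keySide-true i = cong sideOf (satisfied-literal α _ (key-true i))

  noEdge : ∀ {σ x y} → Consistent σ → configuration σ x ≡ true → configuration σ y ≡ true →
           ¬ Edge k Φ x y
  noEdge {σ} _ hx hy (pathC i a b b≡a+1) =
    1+n≢n (trans (sym b≡a+1)
      (cong toℕ (v-injectiveʳ (clause-occupied-unique {σ} (v i b) (v i a) refl refl hy hx))))
  noEdge {σ} _ hx hy (k0L i b _) with clause-occupied-unique {σ} (kc0 i) (v i b) refl refl hx hy
  ... | ()
  noEdge {σ} _ hx hy (k0R i b _) with clause-occupied-unique {σ} (kc0 i) (v i b) refl refl hx hy
  ... | ()
  noEdge {σ} _ hx hy (k2L i b _) with clause-occupied-unique {σ} (kc2 i) (v i b) refl refl hx hy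
  ... | ()
  noEdge {σ} _ hx hy (k2R i b _) with clause-occupied-unique {σ} (kc2 i) (v i b) refl refl hx hy
  ... | ()
  noEdge {σ} _ hx hy (pathV j a b b≡a+1) = variablePath-noEdge (σ (inj₂ j)) b≡a+1 hx hy
  noEdge {σ} _ hx hy (st j c a a≡0) = side-t₀-noEdge (σ (inj₂ j)) a≡0 hx hy
  noEdge {σ} σ-ok hx hy (clique _ _ (inK i r) (inK i′ r′) x≢y)
    with occupied-kv {σ} i r hx | occupied-kv {σ} i′ r′ hy
  ... | i-midway , _ | i′-midway , _ with Consistent.midway-unique σ-ok i-midway i′-midway
  ... | refl = x≢y (clause-occupied-unique {σ} (kv i r) (kv i r′) (owner-kv i r) (owner-kv i r′) hx hy)
  noEdge {σ} σ-ok hx hy (litS i r) with occupied-kv {σ} i r hy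
  ... | i-midway , refl =
    sideOf-not _ (α _) (trans (sym (keySide-true i))
      (occupied-midway-s _ _ (occupied-at {σ} (s _ _) refl (Consistent.midway-lifted σ-ok i-midway) hx)))
  noEdge {σ} σ-ok hx hy (litT i r a a≡0) with occupied-kv {σ} i r hy
  ... | i-midway , refl =
    midway-t₀-empty (var (Φ i (key i))) a≡0
      (occupied-at {σ} (u _ a) refl (Consistent.midway-lifted σ-ok i-midway) hx)

  consistent⇒independent : ∀ {σ} → Consistent σ → Independent (Adj k Φ) (configuration σ)
  consistent⇒independent σ-ok x y hx hy (inj₁ x—y) = noEdge σ-ok hx hy x—y
  consistent⇒independent σ-ok x y hx hy (inj₂ y—x) = noEdge σ-ok hy hx y—x

  Move : Fin m ⊎ Fin n → Stage → Stage → Set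
  Move = GadgetMove (Adj k Φ) k

  liftMove : ∀ j → Move (inj₂ j) initial midway
  liftMove j = record
    { from          = s j (trueSide j)
    ; to            = u j lastU
    ; from-owned    = refl
    ; to-owned      = refl
    ; from-before   = refl
    ; from-after    = dec-false (trueSide j ≟ᶠ falseSide j) (sideOf-not j (α j))
    ; to-before     = refl
    ; to-after      = ≡⇒≡ᵇ-true (toℕ-fromℕ (2 + q))
    ; others        = others
    ; from-to-close = k , ≤-refl , cons (inj₁ (st j (trueSide j) zero refl))
                                        (variablePath j (2 + q) (sym (toℕ-fromℕ (2 + q))))
    }
    where
      others : ∀ z → owner z ≡ inj₂ j → z ≢ s j (trueSide j) → z ≢ u j lastU →
               occupies initial z ≡ occupies midway z
      others (u j a) refl _ a≢last =
        sym (≢⇒≡ᵇ-false (≢⇒toℕ≢ (a≢last ∘ cong (u j)) (toℕ-fromℕ (2 + q))))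
      others (s j c) refl c≢true _ with sideOf-either j (α j) c
      ... | inj₁ c≡true = ⊥-elim (c≢true (cong (s j) c≡true))
      ... | inj₂ c≡false = sym (dec-true (c ≟ᶠ falseSide j) c≡false)

  settleMove : ∀ j → Move (inj₂ j) midway final
  settleMove j = record
    { from          = s j (falseSide j)
    ; to            = u j zero
    ; from-owned    = refl
    ; to-owned      = refl
    ; from-before   = dec-true (falseSide j ≟ᶠ falseSide j) refl
    ; from-after    = refl
    ; to-before     = refl
    ; to-after      = refl
    ; others        = others
    ; from-to-close = 1 , s≤s z≤n , cons (inj₁ (st j (falseSide j) zero refl)) nil
    }
    where
      others : ∀ z → owner z ≡ inj₂ j → z ≢ s j (falseSide j) → z ≢ u j zero →
               occupies midway z ≡ occupies final z
      others (u j a) refl _ a≢0 =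
        sym (cong (_∨ (toℕ a ≡ᵇ k ∸ 1)) (≢⇒≡ᵇ-false (a≢0 ∘ cong (u j) ∘ toℕ-injective)))
      others (s j c) refl c≢false _ = dec-false (c ≟ᶠ falseSide j) (c≢false ∘ cong (s j))

  clauseMove : ∀ {t t′} i → clauseToken t i ≢ clauseToken t′ i →
               DistLe (Adj k Φ) k (clauseToken t i) (clauseToken t′ i) → Move (inj₁ i) t t′
  clauseMove {t} {t′} i token≢token′ close = record
    { from          = clauseToken t i
    ; to            = clauseToken t′ i
    ; from-owned    = owner-clauseToken t i
    ; to-owned      = owner-clauseToken t′ i
    ; from-before   = clauseToken-occupied t i
    ; from-after    = clause-empty t′ _ (owner-clauseToken t i) token≢token′
    ; to-before     = clause-empty t _ (owner-clauseToken t′ i) (token≢token′ ∘ sym)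
    ; to-after      = clauseToken-occupied t′ i
    ; others        = λ z z∈i z≢token z≢token′ →
                        trans (clause-empty t z z∈i z≢token) (sym (clause-empty t′ z z∈i z≢token′))
    ; from-to-close = close
    }

  keyMove : ∀ i → Move (inj₁ i) initial midway
  keyMove i = clauseMove i (v₀≢kv i (key i)) (dist-v₀-kv i (key i))

  closeMove : ∀ i → Move (inj₁ i) midway final
  closeMove i = clauseMove i (v₂ₖ≢kv i (key i) ∘ sym) (dist-kv-v₂ₖ i (key i))

  clauseJump : ∀ {Y Y′ X i t t′} → Y ≗ Y′ except i → Y i ≡ t → Y′ i ≡ t′ → Move (inj₁ i) t t′ →
               JumpStep (Adj k Φ) k (tokens Y X) (tokens Y′ X)
  clauseJump agree = jumpStep-gadget (except-inj₁ agree)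

  variableJump : ∀ {Y X X′ j t t′} → X ≗ X′ except j → X j ≡ t → X′ j ≡ t′ → Move (inj₂ j) t t′ →
                 JumpStep (Adj k Φ) k (tokens Y X) (tokens Y X′)
  variableJump agree = jumpStep-gadget (except-inj₂ agree)

  noneMidway⇒consistent : ∀ {σ} → (∀ i → σ (inj₁ i) ≢ midway) → Consistent σ
  noneMidway⇒consistent none = record
    { midway-unique = λ {i} i-midway _ → ⊥-elim (none i i-midway)
    ; midway-lifted = λ {i} i-midway → ⊥-elim (none i i-midway)
    }

  lifted : ℕ → Fin n → Stage
  lifted p = overwriteBelow p midway (const initial)

  settled : ℕ → Fin n → Stage
  settled p = overwriteBelow p final (lifted n)

  closed : ℕ → Fin m → Stage
  closed p = overwriteBelow p final (const initial)

  closed-notMidway : ∀ p i → closed p i ≢ midway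
  closed-notMidway p i with toℕ i <ᵇ p
  ... | true = λ ()
  ... | false = λ ()

  closed⇒consistent : ∀ p {X} → Consistent [ closed p , X ]′
  closed⇒consistent p = noneMidway⇒consistent (closed-notMidway p)

  variableSweep : ∀ {t t′} Y X → (∀ j → X j ≡ t) → (∀ p → Consistent [ Y , overwriteBelow p t′ X ]′) →
                  (∀ j → Move (inj₂ j) t t′) →
                  Reconf (tokens Y X) (tokens Y (overwriteBelow n t′ X)) (n * 1)
  variableSweep {t} {t′} Y X X≡t consistent move =
    sweep (λ p → tokens Y (overwriteBelow p t′ X)) n (consistent⇒independent (consistent 0)) step
    where
      step : ∀ p → p < n →
             Reconf (tokens Y (overwriteBelow p t′ X)) (tokens Y (overwriteBelow (suc p) t′ X)) 1
      step p p<n =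
        single (consistent⇒independent (consistent p)) (consistent⇒independent (consistent (suc p)))
          (variableJump (overwriteBelow-1+-except p<n t′ X) (trans (overwriteBelow-at p<n t′ X) (X≡t _))
            (overwriteBelow-1+-at p<n t′ X) (move (fromℕ< p<n)))

  clauseSweep : ∀ X → (∀ j → X j ≡ midway) → Reconf (tokens (const initial) X) (tokens (closed m) X) (m * 2)
  clauseSweep X X≡midway =
    sweep (λ p → tokens (closed p) X) m (consistent⇒independent (closed⇒consistent 0)) visit
    where
      visit : ∀ p → p < m → Reconf (tokens (closed p) X) (tokens (closed (suc p)) X) 2
      visit p p<m =
        jump (consistent⇒independent (closed⇒consistent p)) keying
          (single (consistent⇒independent keyed-consistent)
                  (consistent⇒independent (closed⇒consistent (suc p))) closing)
        where
          i : Fin m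
          i = fromℕ< p<m
          keyed : Fin m → Stage
          keyed = updateAt (closed p) i (const midway)
          keyed-midway⇒≡i : ∀ {i′} → keyed i′ ≡ midway → i′ ≡ i
          keyed-midway⇒≡i {i′} i′-midway with i′ ≟ᶠ i
          ... | yes i′≡i = i′≡i
          ... | no i′≢i =
            ⊥-elim (closed-notMidway p i′ (trans (sym (updateAt-minimal i′ i (closed p) i′≢i)) i′-midway))
          keyed-consistent : Consistent [ keyed , X ]′
          keyed-consistent = record
            { midway-unique = λ i₁-midway i₂-midway →
                                trans (keyed-midway⇒≡i i₁-midway) (sym (keyed-midway⇒≡i i₂-midway))
            ; midway-lifted = λ _ → X≡midway _
            }
          keying : JumpStep (Adj k Φ) k (tokens (closed p) X) (tokens keyed X)
          keying = clauseJump (λ i′ i′≢i → sym (updateAt-minimal i′ i (closed p) i′≢i))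
                     (overwriteBelow-at p<m final (const initial)) (updateAt-updates i (closed p)) (keyMove i)
          closing : JumpStep (Adj k Φ) k (tokens keyed X) (tokens (closed (suc p)) X)
          closing = clauseJump (λ i′ i′≢i → trans (updateAt-minimal i′ i (closed p) i′≢i)
                                                  (overwriteBelow-1+-except p<m final (const initial) i′ i′≢i))
                      (updateAt-updates i (closed p)) (overwriteBelow-1+-at p<m final (const initial)) (closeMove i)

  lifting : Reconf (tokens (const initial) (const initial)) (tokens (const initial) (lifted n)) (n * 1)
  lifting = variableSweep (const initial) (const initial) (λ _ → refl)
              (λ _ → noneMidway⇒consistent (λ _ ())) liftMove

  visiting : Reconf (tokens (const initial) (lifted n)) (tokens (closed m) (lifted n)) (m * 2)
  visiting = clauseSweep (lifted n) (overwriteBelow-all midway (const initial))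

  settling : Reconf (tokens (closed m) (lifted n)) (tokens (closed m) (settled n)) (n * 1)
  settling = variableSweep (closed m) (lifted n) (overwriteBelow-all midway (const initial))
               (λ _ → closed⇒consistent m) settleMove

  start≐Is : tokens (const initial) (const initial) ≐ Is k
  start≐Is (v i a) = refl
  start≐Is (kc0 i) = refl
  start≐Is (kc2 i) = refl
  start≐Is (u j a) = refl
  start≐Is (s j c) = refl

  final≐It : configuration (const final) ≐ It k
  final≐It (v i a) = refl
  final≐It (kc0 i) = refl
  final≐It (kc2 i) = refl
  final≐It (u j a) = refl
  final≐It (s j c) = refl

  end≐It : tokens (closed m) (settled n) ≐ It k
  end≐It z = trans (configuration-cong all-final z) (final≐It z)
    where
      all-final : ∀ g → [ closed m , settled n ]′ g ≡ final
      all-final (inj₁ i) = overwriteBelow-all final (const initial) i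
      all-final (inj₂ j) = overwriteBelow-all final (lifted n) j

phase-lengths : ∀ m n → n * 1 + (m * 2 + n * 1) ≡ 2 * (m + n)
phase-lengths = solve-∀

lemma10 : (k : ℕ) → 3 ≤ k → (m n : ℕ) (Φ : Formula m n) → IsE3 Φ → Satisfiable Φ →
          ∃[ ℓ ] (ℓ ≤ 2 * (m + n) × ReconfSeq (Adj k Φ) k (Is k) (It k) ℓ)
-- The literals of a clause need not be distinct for this direction.
lemma10 (suc (suc (suc q))) (s≤s (s≤s (s≤s z≤n))) m n Φ _ (α , sat) =
  n * 1 + (m * 2 + n * 1) , ≤-reflexive (phase-lengths m n) ,
  toReconfSeq (lifting ++ᴿ visiting ++ᴿ settling) start≐Is end≐It
  where
    open Construction q Φ α (proj₁ ∘ sat) (proj₂ ∘ sat)
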